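{- Let $(\mathcal{L},\mathcal{R})$ be an lr-pair in $2^{[n']}$. (i) Suppose there are $X\subseteq[n']$ and $i,j,k\in X$ with $i<j<k$ such that $X-\{k\},X-\{j\}\in\mathcal{L}$ and $X-\{j\},X-\{i\}\in\mathcal{R}$. Then $(\mathcal{L}\cup\{X\},\mathcal{R})$ is an lr-pair. (ii) Suppose there are $X\subseteq[n']$ and $i,j,k\in[n']-X$ with $i<j<k$ such that $X\cup\{i\},X\cup\{j\}\in\mathcal{L}$ and $X\cup\{j\},X\cup\{k\}\in\mathcal{R}$. Then $(\mathcal{L},\mathcal{R}\cup\{X\})$ is an lr-pair.
   Context: For $A,B\subseteq[n']$ write $A\lessdot B$ if $B-A\neq\emptyset$ and $i<j$ for all $i\in A-B$, $j\in B-A$; write $A\,\underline{\lessdot}\,B$ if $A\lessdot B$ or $A=B$. Write $A\rhd B$ if both $A-B$ and $B-A$ are nonempty and $B-A$ is a disjoint union $B'\sqcup B''$ of nonempty sets with $b'<a<b''$ for all $b'\in B'$, $a\in A-B$, $b''\in B''$. Sets $A,B$ are weakly separated if $A\lessdot B$, or $B\lessdot A$, or ($A\rhd B$ and $|A|\ge|B|$), or ($B\rhd A$ and $|B|\ge|A|$), or $A=B$; a ws-collection is a family of sets pairwise weakly separated. A pair $(\mathcal{L},\mathcal{R})$ of families $\mathcal{L},\mathcal{R}\subseteq 2^{[n']}$ is an lr-pair if $\mathcal{L}\cup\mathcal{R}$ is a ws-collection and $L\,\underline{\lessdot}\,R$ holds for all $L\in\mathcal{L}$, $R\in\mathcal{R}$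 with $|L|\le|R|$. -}

module Defs where

open import Data.Nat using (ℕ; _≤_; _≥_)
open import Data.Fin using (Fin) renaming (_<_ to _<ᶠ_)
open import Data.Fin.Subset using (Subset; _∈_; _∉_; _─_; _∪_; _∩_; ∣_∣; Nonempty; ⁅_⁆; ⊥)
open import Data.Product using (_×_; Σ; ∃)
open import Data.Sum using (_⊎_)
open import Relation.Binary.PropositionalEquality using (_≡_)

-- [n'] is modelled by Fin n (elements 0..n-1 with their natural order);
-- subsets of [n'] are Data.Fin.Subset n.

_⋖_ : {n : ℕ} → Subset n → Subset n → Set
_⋖_ {n} A B = Nonempty (B ─ A) ×
  ((i j : Fin n) → i ∈ (A ─ B) → j ∈ (B ─ A) → i <ᶠ j)

_⋖=_ : {n : ℕ} → Subset n → Subset n → Set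
A ⋖= B = A ⋖ B ⊎ A ≡ B

_▷_ : {n : ℕ} → Subset n → Subset n → Set
_▷_ {n} A B = Nonempty (A ─ B) × Nonempty (B ─ A) ×
  Σ (Subset n) λ B' → Σ (Subset n) λ B'' →
    Nonempty B' × Nonempty B'' × (B' ∩ B'' ≡ ⊥) × (B' ∪ B'' ≡ B ─ A) ×
    ((b' a b'' : Fin n) → b' ∈ B' → a ∈ (A ─ B) → b'' ∈ B'' →
       (b' <ᶠ a) × (a <ᶠ b''))

WeaklySeparated : {n : ℕ} → Subset n → Subset n → Set
WeaklySeparated A B =
  A ⋖ B ⊎ B ⋖ A ⊎ (A ▷ B × ∣ A ∣ ≥ ∣ B ∣) ⊎ (B ▷ A × ∣ B ∣ ≥ ∣ A ∣) ⊎ A ≡ B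

Family : ℕ → Set₁
Family n = Subset n → Set

_∪ᶠ_ : {n : ℕ} → Family n → Family n → Family n
(F ∪ᶠ G) Y = F Y ⊎ G Y

singleton : {n : ℕ} → Subset n → Family n
singleton X Y = Y ≡ X

WSCollection : {n : ℕ} → Family n → Set
WSCollection {n} F = (A B : Subset n) → F A → F B → WeaklySeparated A B

record LRPair {n : ℕ} (L R : Family n) : Set where
  field
    ws : WSCollection (L ∪ᶠ R)
    lr : (A B : Subset n) → L A → R B → ∣ A ∣ ≤ ∣ B ∣ → A ⋖= B

module Submission where

-- The proof works with two order patterns of a pair of sets A, B ⊆ [n'].  An inversion
-- of (A, B) is an element of B − A lying before an element of A − B; an alternation of (A, B) is
-- a < b < a′ with a, a′ ∈ A − B and b ∈ B − A.  We first show that weak separation is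
-- controlled by these patterns: A ⋖= B excludes inversions (and for |A| ≤ |B| is equivalent
-- to their absence), an alternation of (A, B) in a weakly separated pair forces |A| ≤ |B|, and
-- conversely A, B are weakly separated as soon as alternations in the two directions do not
-- coexist and each is compatible with the sizes (the set B' ⊔ B'' of ▷ is built by selection).
--
-- Part (i) is then a counting argument: an alternation between X and a member Y survives in
-- X − c for a suitable c ∈ {i, j, k}, so the hypotheses on the sets X − c bound |Y| against
-- |X|, and the lr-condition for X − c rules out the remaining configurations.
-- Part (ii) is part (i) for the complementary pair (R ∘ ∁, L ∘ ∁): complementation
-- X ↦ [n'] − X reverses ⋖, ▷ and the sizes, hence maps lr-pairs to lr-pairs.

open import Defs
open import Data.Nat using (ℕ)
open import Data.Fin using (Fin; _<_)
open import Data.Fin.Subset using (Subset; _∈_; _∉_; _-_; _∪_; ⁅_⁆)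
open import Data.Product using (_×_)

open import Data.Nat using (suc; _≤_; _≤?_; s≤s; s≤s⁻¹) renaming (_<_ to _<ℕ_)
import Data.Nat.Properties as ℕₚ
open import Data.Fin.Properties using (_≟_; _<?_; <-cmp; <-asym; <-trans; <⇒≢; any?)
open import Data.Fin.Subset
  using (_─_; ∁; _⊆_; _⊂_; ∣_∣; Nonempty; inside; outside)
open import Data.Fin.Subset.Properties
  using ( _∈?_; nonempty?; ⊆-antisym; ∉⊥; x∈p∩q⁻; x∈p∪q⁻; x∈p∪q⁺; p─q⊆p
        ; x∈p∧x∉q⇒x∈p─q; x∈p∧x≢y⇒x∈p-y; x∈p⇒∣p-x∣<∣p∣; p⊂q⇒∣p∣<∣q∣
        ; x∉p⇒x∈∁p; ∣∁p∣≡n∸∣p∣; p─⊥≡p)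
open import Data.Vec using (_∷_; []; tabulate; here; there)
open import Data.Vec.Properties using (lookup∘tabulate; []=⇒lookup; lookup⇒[]=; map-∘; map-cong; map-id)
open import Data.Bool using (not)
open import Data.Bool.Properties using (not-involutive)
open import Data.Product using (_,_; proj₁; proj₂)
open import Data.Sum using (_⊎_; inj₁; inj₂; [_,_]′; swap) renaming (map to ⊎-map)
open import Data.Empty using (⊥-elim)
open import Function using (_∘_)
open import Relation.Nullary using (¬_; Dec; yes; no; does)
open import Relation.Nullary.Decidable using (_×-dec_; ¬?; map′; dec-true)
open import Relation.Binary using (tri<; tri≈; tri>)
open import Relation.Binary.PropositionalEquality
  using (_≡_; _≢_; refl; sym; trans; cong; subst; subst₂; ≢-sym)

private
  variable
    n : ℕ
    A B : Subset n
    x y : Fin n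

infix 4 _∈_∖_

_∈_∖_ : Fin n → Subset n → Subset n → Set
x ∈ A ∖ B = x ∈ A × x ∉ B

_∈?_∖_ : (x : Fin n) (A B : Subset n) → Dec (x ∈ A ∖ B)
x ∈? A ∖ B = (x ∈? A) ×-dec ¬? (x ∈? B)

∈─⇒∉ : ∀ (A B : Subset n) → x ∈ A ─ B → x ∉ B
∈─⇒∉ (_ ∷ A) (inside  ∷ B) ()        here
∈─⇒∉ (_ ∷ A) (outside ∷ B) here      ()
∈─⇒∉ (_ ∷ A) (_       ∷ B) (there p) (there q) = ∈─⇒∉ A B p q

∈─⇒∈∖ : x ∈ A ─ B → x ∈ A ∖ B
∈─⇒∈∖ {A = A} {B = B} x∈ = p─q⊆p A B x∈ , ∈─⇒∉ A B x∈

∈∖⇒∈─ : x ∈ A ∖ B → x ∈ A ─ B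
∈∖⇒∈─ (x∈A , x∉B) = x∈p∧x∉q⇒x∈p─q x∈A x∉B

∖-distinct : x ∈ A ∖ B → y ∈ B ∖ A → x ≢ y
∖-distinct (x∈A , _) (_ , y∉A) refl = y∉A x∈A

¬nonempty─⇒⊆ : ¬ Nonempty (A ─ B) → A ⊆ B
¬nonempty─⇒⊆ {A = A} {B = B} empty {x} x∈A with x ∈? B
... | yes x∈B = x∈B
... | no  x∉B = ⊥-elim (empty (x , x∈p∧x∉q⇒x∈p─q x∈A x∉B))

select : {P : Fin n → Set} → ((x : Fin n) → Dec (P x)) → Subset n
select P? = tabulate (λ x → does (P? x))

select⁺ : {P : Fin n → Set} (P? : (x : Fin n) → Dec (P x)) → P x → x ∈ select P?
select⁺ {x = x} P? p = lookup⇒[]= x _ (trans (lookup∘tabulate _ x) (dec-true (P? x) p))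

select⁻ : {P : Fin n → Set} (P? : (x : Fin n) → Dec (P x)) → x ∈ select P? → P x
select⁻ {x = x} P? x∈ with P? x | trans (sym (lookup∘tabulate _ x)) ([]=⇒lookup x∈)
... | yes p | _  = p
... | no  _ | ()

data Inversion (A B : Subset n) : Set where
  inversion : ∀ b a → b ∈ B ∖ A → a ∈ A ∖ B → b < a → Inversion A B

data Alternation (A B : Subset n) : Set where
  alternation : ∀ a b a′ → a ∈ A ∖ B → b ∈ B ∖ A → a′ ∈ A ∖ B → a < b → b < a′ →
                Alternation A B

alternation⇒inversions : Alternation A B → Inversion A B × Inversion B A
alternation⇒inversions (alternation a b a′ a∈ b∈ a′∈ a<b b<a′) =
  inversion b a′ b∈ a′∈ b<a′ , inversion a b a∈ b∈ a<b

inversion? : (A B : Subset n) → Dec (Inversion A B)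
inversion? A B =
  map′ (λ (b , a , b∈ , a∈ , b<a) → inversion b a b∈ a∈ b<a)
       (λ { (inversion b a b∈ a∈ b<a) → b , a , b∈ , a∈ , b<a })
       (any? λ b → any? λ a → (b ∈? B ∖ A) ×-dec (a ∈? A ∖ B) ×-dec (b <? a))

alternation? : (A B : Subset n) → Dec (Alternation A B)
alternation? A B =
  map′ (λ (a , b , a′ , a∈ , b∈ , a′∈ , a<b , b<a′) → alternation a b a′ a∈ b∈ a′∈ a<b b<a′)
       (λ { (alternation a b a′ a∈ b∈ a′∈ a<b b<a′) → a , b , a′ , a∈ , b∈ , a′∈ , a<b , b<a′ })
       (any? λ a → any? λ b → any? λ a′ →
         (a ∈? A ∖ B) ×-dec (b ∈? B ∖ A) ×-dec (a′ ∈? A ∖ B) ×-dec (a <? b) ×-dec (b <? a′))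

ws-sym : WeaklySeparated A B → WeaklySeparated B A
ws-sym (inj₁ A⋖B)                    = inj₂ (inj₁ A⋖B)
ws-sym (inj₂ (inj₁ B⋖A))             = inj₁ B⋖A
ws-sym (inj₂ (inj₂ (inj₁ A▷B)))      = inj₂ (inj₂ (inj₂ (inj₁ A▷B)))
ws-sym (inj₂ (inj₂ (inj₂ (inj₁ B▷A)))) = inj₂ (inj₂ (inj₁ B▷A))
ws-sym (inj₂ (inj₂ (inj₂ (inj₂ A≡B)))) = inj₂ (inj₂ (inj₂ (inj₂ (sym A≡B))))

ws-refl : WeaklySeparated A A
ws-refl = inj₂ (inj₂ (inj₂ (inj₂ refl)))

⋖-no-inversion : A ⋖ B → ¬ Inversion A B
⋖-no-inversion (_ , ordered) (inversion b a b∈ a∈ b<a) =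
  <-asym b<a (ordered a b (∈∖⇒∈─ a∈) (∈∖⇒∈─ b∈))

⋖=-no-inversion : A ⋖= B → ¬ Inversion A B
⋖=-no-inversion (inj₁ A⋖B) = ⋖-no-inversion A⋖B
⋖=-no-inversion (inj₂ refl) (inversion b a (b∈A , b∉A) _ _) = b∉A b∈A

-- If B − A surrounds A − B, no element of B − A lies between two elements of A − B.
▷-no-alternation : A ▷ B → ¬ Alternation A B
▷-no-alternation (_ , _ , B′ , B″ , (b′ , b′∈) , (b″ , b″∈) , _ , B′∪B″ , around)
                 (alternation a b a′ a∈ b∈ a′∈ a<b b<a′)
  with x∈p∪q⁻ B′ B″ (subst (b ∈_) (sym B′∪B″) (∈∖⇒∈─ b∈))
... | inj₁ b∈B′ = <-asym a<b (proj₁ (around b a b″ b∈B′ (∈∖⇒∈─ a∈) b″∈))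
... | inj₂ b∈B″ = <-asym b<a′ (proj₂ (around b′ a′ b b′∈ (∈∖⇒∈─ a′∈) b∈B″))

-- In a weakly separated pair, an alternation of (A, B) forces B ▷ A, hence |A| ≤ |B|.
ws-alternation-size : WeaklySeparated A B → Alternation A B → ∣ A ∣ ≤ ∣ B ∣
ws-alternation-size (inj₁ A⋖B) alt = ⊥-elim (⋖-no-inversion A⋖B (proj₁ (alternation⇒inversions alt)))
ws-alternation-size (inj₂ (inj₁ B⋖A)) alt = ⊥-elim (⋖-no-inversion B⋖A (proj₂ (alternation⇒inversions alt)))
ws-alternation-size (inj₂ (inj₂ (inj₁ (A▷B , _)))) alt = ⊥-elim (▷-no-alternation A▷B alt)
ws-alternation-size (inj₂ (inj₂ (inj₂ (inj₁ (_ , A≤B))))) _ = A≤B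
ws-alternation-size (inj₂ (inj₂ (inj₂ (inj₂ refl)))) (alternation _ _ _ (a∈A , a∉A) _ _ _ _) =
  ⊥-elim (a∉A a∈A)

no-inversion-ordered : ¬ Inversion A B → x ∈ A ∖ B → y ∈ B ∖ A → x < y
no-inversion-ordered {x = x} {y} ¬inv x∈ y∈ with <-cmp x y
... | tri< x<y _ _ = x<y
... | tri≈ _ x≡y _ = ⊥-elim (∖-distinct x∈ y∈ x≡y)
... | tri> _ _ y<x = ⊥-elim (¬inv (inversion y x y∈ x∈ y<x))

no-inversion-split : ¬ Inversion A B → A ⋖= B ⊎ B ⊂ A
no-inversion-split {A = A} {B = B} ¬inv with nonempty? (B ─ A)
... | yes B─A≠∅ = inj₁ (inj₁ (B─A≠∅ , λ _ _ x∈ y∈ →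
                    no-inversion-ordered ¬inv (∈─⇒∈∖ x∈) (∈─⇒∈∖ y∈)))
... | no  B─A=∅ with nonempty? (A ─ B)
...   | yes (x , x∈) = inj₂ (¬nonempty─⇒⊆ B─A=∅ , x , ∈─⇒∈∖ x∈)
...   | no  A─B=∅    = inj₁ (inj₂ (⊆-antisym (¬nonempty─⇒⊆ A─B=∅) (¬nonempty─⇒⊆ B─A=∅)))

no-inversion⇒⋖= : ∣ A ∣ ≤ ∣ B ∣ → ¬ Inversion A B → A ⋖= B
no-inversion⇒⋖= A≤B ¬inv with no-inversion-split ¬inv
... | inj₁ A⋖=B = A⋖=B
... | inj₂ B⊂A  = ⊥-elim (ℕₚ.<⇒≱ (p⊂q⇒∣p∣<∣q∣ B⊂A) A≤B)

no-inversion-ws : ¬ Inversion A B → WeaklySeparated A B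
no-inversion-ws ¬inv with no-inversion-split ¬inv
... | inj₁ (inj₁ A⋖B)             = inj₁ A⋖B
... | inj₁ (inj₂ A≡B)             = inj₂ (inj₂ (inj₂ (inj₂ A≡B)))
... | inj₂ (B⊆A , x , x∈A , x∉B) =
  inj₂ (inj₁ ((x , x∈p∧x∉q⇒x∈p─q x∈A x∉B) , λ y _ y∈B─A _ →
    ⊥-elim (proj₂ (∈─⇒∈∖ y∈B─A) (B⊆A (proj₁ (∈─⇒∈∖ y∈B─A))))))

module _ {A B : Subset n} (¬alt : ¬ Alternation A B) where

  below-all : y ∈ B ∖ A → x ∈ A ∖ B → y < x → ∀ {x′} → x′ ∈ A ∖ B → y < x′
  below-all {y = y} {x} y∈ x∈ y<x {x′} x′∈ with <-cmp y x′
  ... | tri< y<x′ _ _ = y<x′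
  ... | tri≈ _ y≡x′ _ = ⊥-elim (∖-distinct x′∈ y∈ (sym y≡x′))
  ... | tri> _ _ x′<y = ⊥-elim (¬alt (alternation x′ y x x′∈ y∈ x∈ x′<y y<x))

  above-all : y ∈ B ∖ A → x ∈ A ∖ B → x < y → ∀ {x′} → x′ ∈ A ∖ B → x′ < y
  above-all {y = y} {x} y∈ x∈ x<y {x′} x′∈ with <-cmp x′ y
  ... | tri< x′<y _ _ = x′<y
  ... | tri≈ _ x′≡y _ = ⊥-elim (∖-distinct x′∈ y∈ x′≡y)
  ... | tri> _ _ y<x′ = ⊥-elim (¬alt (alternation x y x′ x∈ y∈ x′∈ x<y y<x′))

  -- With inversions in both directions but no alternation of (A, B), the set B − A
  -- splits into the nonempty parts below and above an element a of A − B, and these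
  -- surround A − B: this is A ▷ B.
  surround : Inversion A B → Inversion B A → A ▷ B
  surround (inversion b a b∈ a∈ b<a) (inversion a₀ b′ a₀∈ b′∈ a₀<b′) =
    (a , ∈∖⇒∈─ a∈) , (b , ∈∖⇒∈─ b∈) , Below , Above
    , (b , select⁺ below? (b∈ , b<a))
    , (b′ , select⁺ above? (b′∈ , above-all b′∈ a₀∈ a₀<b′ a∈))
    , ⊆-antisym (λ y∈ → ⊥-elim (disjoint (x∈p∩q⁻ Below Above y∈))) (λ y∈ → ⊥-elim (∉⊥ y∈))
    , ⊆-antisym (λ y∈ → ∈∖⇒∈─ (parts (x∈p∪q⁻ Below Above y∈))) (split ∘ ∈─⇒∈∖)
    , λ y x y′ y∈ x∈ y′∈ →
        let (y∈B∖A , y<a) = select⁻ below? y∈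
            (y′∈B∖A , a<y′) = select⁻ above? y′∈
        in below-all y∈B∖A a∈ y<a (∈─⇒∈∖ x∈) , above-all y′∈B∖A a∈ a<y′ (∈─⇒∈∖ x∈)
    where
    below? : (y : Fin n) → Dec (y ∈ B ∖ A × y < a)
    below? y = (y ∈? B ∖ A) ×-dec (y <? a)
    above? : (y : Fin n) → Dec (y ∈ B ∖ A × a < y)
    above? y = (y ∈? B ∖ A) ×-dec (a <? y)
    Below Above : Subset n
    Below = select below?
    Above = select above?
    disjoint : ¬ (y ∈ Below × y ∈ Above)
    disjoint (y∈ , y∈′) = <-asym (proj₂ (select⁻ below? y∈)) (proj₂ (select⁻ above? y∈′))
    parts : y ∈ Below ⊎ y ∈ Above → y ∈ B ∖ A
    parts (inj₁ y∈) = proj₁ (select⁻ below? y∈)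
    parts (inj₂ y∈) = proj₁ (select⁻ above? y∈)
    split : y ∈ B ∖ A → y ∈ Below ∪ Above
    split {y} y∈ with <-cmp y a
    ... | tri< y<a _ _ = x∈p∪q⁺ (inj₁ (select⁺ below? (y∈ , y<a)))
    ... | tri≈ _ y≡a _ = ⊥-elim (∖-distinct a∈ y∈ (sym y≡a))
    ... | tri> _ _ a<y = x∈p∪q⁺ (inj₂ (select⁺ above? (y∈ , a<y)))

  inversions⇒alternation : Inversion A B → Inversion B A → Alternation B A
  inversions⇒alternation (inversion b a b∈ a∈ b<a) (inversion a′ b′ a′∈ b′∈ a′<b′) with <-cmp b a′
  ... | tri< b<a′ _ _ = alternation b a′ b′ b∈ a′∈ b′∈ b<a′ a′<b′
  ... | tri≈ _ b≡a′ _ = ⊥-elim (∖-distinct a′∈ b∈ (sym b≡a′))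
  ... | tri> _ _ a′<b = ⊥-elim (¬alt (alternation a′ b a a′∈ b∈ a∈ a′<b b<a))

ws-criterion : (Alternation A B → ¬ Alternation B A) →
               (Alternation A B → ∣ A ∣ ≤ ∣ B ∣) → (Alternation B A → ∣ B ∣ ≤ ∣ A ∣) →
               WeaklySeparated A B
ws-criterion {A = A} {B = B} not-both size-AB size-BA
  with inversion? A B | inversion? B A
... | no ¬inv | _        = no-inversion-ws ¬inv
... | yes _   | no ¬inv′ = ws-sym (no-inversion-ws ¬inv′)
... | yes inv | yes inv′ with alternation? A B | alternation? B A
...   | yes alt | yes alt′ = ⊥-elim (not-both alt alt′)
...   | no ¬alt | _        =
  inj₂ (inj₂ (inj₁ (surround ¬alt inv inv′ , size-BA (inversions⇒alternation ¬alt inv inv′))))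
...   | yes alt | no ¬alt′ = inj₂ (inj₂ (inj₂ (inj₁ (surround ¬alt′ inv′ inv , size-AB alt))))

ws-by-dominance : {A B : Subset n} → (Alternation B A → ∣ B ∣ <ℕ ∣ A ∣) →
                  (Alternation A B → ¬ (∣ B ∣ <ℕ ∣ A ∣)) → WeaklySeparated A B
ws-by-dominance {A = A} {B} smaller not-smaller =
  ws-criterion (λ alt alt′ → not-smaller alt (smaller alt′)) size (ℕₚ.<⇒≤ ∘ smaller)
  where
  size : Alternation A B → ∣ A ∣ ≤ ∣ B ∣
  size alt with ∣ A ∣ ≤? ∣ B ∣
  ... | yes A≤B = A≤B
  ... | no  A≰B = ⊥-elim (not-smaller alt (ℕₚ.≰⇒> A≰B))

∖-delete-left : ∀ {c} → x ∈ A ∖ B → c ≢ x → x ∈ (A - c) ∖ B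
∖-delete-left (x∈A , x∉B) c≢x = x∈p∧x≢y⇒x∈p-y x∈A (≢-sym c≢x) , x∉B

∖-delete-right : ∀ {c} → x ∈ B ∖ A → x ∈ B ∖ (A - c)
∖-delete-right {A = A} {c = c} (x∈B , x∉A) = x∈B , x∉A ∘ p─q⊆p A ⁅ c ⁆

suc∣p-x∣≡∣p∣ : ∀ (p : Subset n) → x ∈ p → suc ∣ p - x ∣ ≡ ∣ p ∣
suc∣p-x∣≡∣p∣ (inside  ∷ p) here      = cong (suc ∘ ∣_∣) (p─⊥≡p p)
suc∣p-x∣≡∣p∣ (inside  ∷ p) (there m) = cong suc (suc∣p-x∣≡∣p∣ p m)
suc∣p-x∣≡∣p∣ (outside ∷ p) (there m) = suc∣p-x∣≡∣p∣ p m

avoid₂ : ∀ {c₁ c₂ : Fin n} → c₁ ≢ c₂ → (a : Fin n) → c₁ ≢ a ⊎ c₂ ≢ a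
avoid₂ {c₁ = c₁} c₁≢c₂ a with c₁ ≟ a
... | yes refl = inj₂ (≢-sym c₁≢c₂)
... | no  c₁≢a = inj₁ c₁≢a

avoid₃ : ∀ {i j k : Fin n} → i ≢ j → j ≢ k → i ≢ k → (a a′ : Fin n) →
         (i ≢ a × i ≢ a′) ⊎ (j ≢ a × j ≢ a′) ⊎ (k ≢ a × k ≢ a′)
avoid₃ {i = i} i≢j j≢k i≢k a a′ with i ≟ a | i ≟ a′
... | no i≢a | no i≢a′ = inj₁ (i≢a , i≢a′)
... | yes refl | _ with avoid₂ j≢k a′
...   | inj₁ j≢a′ = inj₂ (inj₁ (≢-sym i≢j , j≢a′))
...   | inj₂ k≢a′ = inj₂ (inj₂ (≢-sym i≢k , k≢a′))
avoid₃ i≢j j≢k i≢k a a′ | no _ | yes refl with avoid₂ j≢k a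
...   | inj₁ j≢a = inj₂ (inj₁ (j≢a , ≢-sym i≢j))
...   | inj₂ k≢a = inj₂ (inj₂ (k≢a , ≢-sym i≢k))

-- Part (i), the heart of the argument.  Fix an lr-pair (L, R), distinct i, j, k ∈ X with
-- X − k, X − j ∈ L and X − j, X − i ∈ R.
module Insertion {n : ℕ} {L R : Family n} (P : LRPair L R) {X : Subset n} {i j k : Fin n}
  (i∈X : i ∈ X) (j∈X : j ∈ X) (k∈X : k ∈ X) (i≢j : i ≢ j) (j≢k : j ≢ k) (i≢k : i ≢ k)
  (Lk : L (X - k)) (Lj : L (X - j)) (Rj : R (X - j)) (Ri : R (X - i)) where

  open LRPair P

  -- A right member Y no smaller than the sets X − c has no element of Y − X before an
  -- element x of X − Y: otherwise X − c ⋖= Y fails for the c ∈ {j, k} different from x.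
  right-no-inversion : ∀ {Y} → R Y → (∀ {c} → c ∈ X → ∣ X - c ∣ ≤ ∣ Y ∣) → ¬ Inversion X Y
  right-no-inversion {Y} RY large (inversion y x y∈ x∈ y<x) =
    [ against k∈X Lk , against j∈X Lj ]′ (avoid₂ (≢-sym j≢k) x)
    where
    against : ∀ {c} → c ∈ X → L (X - c) → ¬ (c ≢ x)
    against {c} c∈X LXc c≢x = ⋖=-no-inversion (lr (X - c) Y LXc RY (large c∈X))
      (inversion y x (∖-delete-right y∈) (∖-delete-left x∈ c≢x) y<x)

  -- Dually, a left member Y no larger than the sets X − c has no element x of X − Y
  -- before an element of Y − X: otherwise Y ⋖= X − c fails for the c ∈ {i, j} different from x.
  left-no-inversion : ∀ {Y} → L Y → (∀ {c} → c ∈ X → ∣ Y ∣ ≤ ∣ X - c ∣) → ¬ Inversion Y X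
  left-no-inversion {Y} LY small (inversion x y x∈ y∈ x<y) =
    [ against i∈X Ri , against j∈X Rj ]′ (avoid₂ i≢j x)
    where
    against : ∀ {c} → c ∈ X → R (X - c) → ¬ (c ≢ x)
    against {c} c∈X RXc c≢x = ⋖=-no-inversion (lr Y (X - c) LY RXc (small c∈X))
      (inversion x y (∖-delete-left x∈ c≢x) (∖-delete-right y∈) x<y)

  module _ {Y : Subset n} (Y∈ : (L ∪ᶠ R) Y) where

    ws-deleted : ∀ {c} → (L ∪ᶠ R) (X - c) → WeaklySeparated (X - c) Y
    ws-deleted M = ws _ Y M Y∈

    -- An alternation y < x < y′ of (Y, X) survives in X − c for the c ∈ {i, j} with c ≠ x,
    -- so |Y| ≤ |X − c| < |X|.
    alternation-YX⇒smaller : Alternation Y X → ∣ Y ∣ <ℕ ∣ X ∣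
    alternation-YX⇒smaller (alternation y x y′ y∈ x∈ y′∈ y<x x<y′) =
      [ via i∈X (inj₂ Ri) , via j∈X (inj₁ Lj) ]′ (avoid₂ i≢j x)
      where
      via : ∀ {c} → c ∈ X → (L ∪ᶠ R) (X - c) → c ≢ x → ∣ Y ∣ <ℕ ∣ X ∣
      via c∈X M c≢x = ℕₚ.≤-<-trans
        (ws-alternation-size (ws-sym (ws-deleted M))
          (alternation y x y′ (∖-delete-right y∈) (∖-delete-left x∈ c≢x) (∖-delete-right y′∈) y<x x<y′))
        (x∈p⇒∣p-x∣<∣p∣ c∈X)

    -- An alternation x < y < x′ of (X, Y) survives in X − c for the c ∈ {i, j, k} different
    -- from x, x′, so |X| ≤ |Y| + 1.  If also |Y| < |X|, every X − c has exactly the size of Y,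
    -- and the inversion x < y (if Y ∈ L) or y < x′ (if Y ∈ R) contradicts the lr-condition.
    alternation-XY⇒not-smaller : Alternation X Y → ¬ (∣ Y ∣ <ℕ ∣ X ∣)
    alternation-XY⇒not-smaller (alternation x y x′ x∈ y∈ x′∈ x<y y<x′) Y<X = contradiction Y∈
      where
      via : ∀ {c} → c ∈ X → (L ∪ᶠ R) (X - c) → c ≢ x × c ≢ x′ → ∣ X ∣ ≤ suc ∣ Y ∣
      via c∈X M (c≢x , c≢x′) = subst (_≤ suc ∣ Y ∣) (suc∣p-x∣≡∣p∣ X c∈X) (s≤s
        (ws-alternation-size (ws-deleted M)
          (alternation x y x′ (∖-delete-left x∈ c≢x) (∖-delete-right y∈) (∖-delete-left x′∈ c≢x′) x<y y<x′)))
      X≤1+Y : ∣ X ∣ ≤ suc ∣ Y ∣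
      X≤1+Y = [ via i∈X (inj₂ Ri) , [ via j∈X (inj₁ Lj) , via k∈X (inj₁ Lk) ]′ ]′
                (avoid₃ i≢j j≢k i≢k x x′)
      deleted≤Y : ∀ {c} → c ∈ X → ∣ X - c ∣ ≤ ∣ Y ∣
      deleted≤Y c∈X = s≤s⁻¹ (subst (_≤ suc ∣ Y ∣) (sym (suc∣p-x∣≡∣p∣ X c∈X)) X≤1+Y)
      Y≤deleted : ∀ {c} → c ∈ X → ∣ Y ∣ ≤ ∣ X - c ∣
      Y≤deleted c∈X = s≤s⁻¹ (subst (suc ∣ Y ∣ ≤_) (sym (suc∣p-x∣≡∣p∣ X c∈X)) Y<X)
      contradiction : ¬ (L Y ⊎ R Y)
      contradiction (inj₁ LY) = left-no-inversion LY Y≤deleted (inversion x y x∈ y∈ x<y)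
      contradiction (inj₂ RY) = right-no-inversion RY deleted≤Y (inversion y x′ y∈ x′∈ y<x′)

    ws-X : WeaklySeparated X Y
    ws-X = ws-by-dominance alternation-YX⇒smaller alternation-XY⇒not-smaller

  -- X ⋖= Y for every right member Y with |X| ≤ |Y|, as then |X − c| ≤ |Y| for all c.
  lr-X : ∀ {Y} → R Y → ∣ X ∣ ≤ ∣ Y ∣ → X ⋖= Y
  lr-X RY X≤Y = no-inversion⇒⋖= X≤Y
    (right-no-inversion RY λ c∈X → ℕₚ.≤-trans (ℕₚ.<⇒≤ (x∈p⇒∣p-x∣<∣p∣ c∈X)) X≤Y)

extend-left : {L R : Family n} {X : Subset n} → LRPair L R →
              (∀ {Y} → (L ∪ᶠ R) Y → WeaklySeparated X Y) →
              (∀ {Y} → R Y → ∣ X ∣ ≤ ∣ Y ∣ → X ⋖= Y) →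
              LRPair (L ∪ᶠ singleton X) R
extend-left {L = L} {R} {X} P ws-X lr-X = record { ws = ws′ ; lr = lr′ }
  where
  open LRPair P
  member : ∀ {Y} → ((L ∪ᶠ singleton X) ∪ᶠ R) Y → (L ∪ᶠ R) Y ⊎ Y ≡ X
  member (inj₁ (inj₁ LY)) = inj₁ (inj₁ LY)
  member (inj₁ (inj₂ Y≡X)) = inj₂ Y≡X
  member (inj₂ RY) = inj₁ (inj₂ RY)
  ws′ : WSCollection ((L ∪ᶠ singleton X) ∪ᶠ R)
  ws′ A B A∈ B∈ with member A∈ | member B∈
  ... | inj₁ A∈′ | inj₁ B∈′ = ws A B A∈′ B∈′
  ... | inj₁ A∈′ | inj₂ refl = ws-sym (ws-X A∈′)
  ... | inj₂ refl | inj₁ B∈′ = ws-X B∈′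
  ... | inj₂ refl | inj₂ refl = ws-refl
  lr′ : (A B : Subset _) → (L ∪ᶠ singleton X) A → R B → ∣ A ∣ ≤ ∣ B ∣ → A ⋖= B
  lr′ A B (inj₁ LA) RB = lr A B LA RB
  lr′ A B (inj₂ refl) RB = lr-X RB

insertion-left : {L R : Family n} → LRPair L R → {X : Subset n} {i j k : Fin n} →
                 i ∈ X → j ∈ X → k ∈ X → i ≢ j → j ≢ k → i ≢ k →
                 L (X - k) → L (X - j) → R (X - j) → R (X - i) →
                 LRPair (L ∪ᶠ singleton X) R
insertion-left P i∈X j∈X k∈X i≢j j≢k i≢k Lk Lj Rj Ri = extend-left P ws-X lr-X
  where open Insertion P i∈X j∈X k∈X i≢j j≢k i≢k Lk Lj Rj Ri

∁-involutive : ∀ (p : Subset n) → ∁ (∁ p) ≡ p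
∁-involutive p = trans (sym (map-∘ not not p)) (trans (map-cong not-involutive p) (map-id p))

∁─∁ : ∀ (p q : Subset n) → ∁ p ─ ∁ q ≡ q ─ p
∁─∁ []            []            = refl
∁─∁ (inside  ∷ p) (inside  ∷ q) = cong (outside ∷_) (∁─∁ p q)
∁─∁ (inside  ∷ p) (outside ∷ q) = cong (outside ∷_) (∁─∁ p q)
∁─∁ (outside ∷ p) (inside  ∷ q) = cong (inside  ∷_) (∁─∁ p q)
∁─∁ (outside ∷ p) (outside ∷ q) = cong (outside ∷_) (∁─∁ p q)

∁[∁p─q]≡p∪q : ∀ (p q : Subset n) → ∁ (∁ p ─ q) ≡ p ∪ q
∁[∁p─q]≡p∪q []            []            = refl
∁[∁p─q]≡p∪q (inside  ∷ p) (inside  ∷ q) = cong (inside  ∷_) (∁[∁p─q]≡p∪q p q)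
∁[∁p─q]≡p∪q (inside  ∷ p) (outside ∷ q) = cong (inside  ∷_) (∁[∁p─q]≡p∪q p q)
∁[∁p─q]≡p∪q (outside ∷ p) (inside  ∷ q) = cong (inside  ∷_) (∁[∁p─q]≡p∪q p q)
∁[∁p─q]≡p∪q (outside ∷ p) (outside ∷ q) = cong (outside ∷_) (∁[∁p─q]≡p∪q p q)

∁-antitone : ∀ (A B : Subset n) → ∣ A ∣ ≤ ∣ B ∣ → ∣ ∁ B ∣ ≤ ∣ ∁ A ∣
∁-antitone {n} A B A≤B =
  subst₂ _≤_ (sym (∣∁p∣≡n∸∣p∣ B)) (sym (∣∁p∣≡n∸∣p∣ A)) (ℕₚ.∸-monoʳ-≤ n A≤B)

∁-⋖ : A ⋖ B → ∁ B ⋖ ∁ A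
∁-⋖ {A = A} {B = B} (B─A≠∅ , ordered) =
  subst Nonempty (sym (∁─∁ A B)) B─A≠∅ ,
  λ x y x∈ y∈ → ordered x y (subst (x ∈_) (∁─∁ B A) x∈) (subst (y ∈_) (∁─∁ A B) y∈)

∁-⋖= : A ⋖= B → ∁ B ⋖= ∁ A
∁-⋖= (inj₁ A⋖B) = inj₁ (∁-⋖ A⋖B)
∁-⋖= (inj₂ A≡B) = inj₂ (cong ∁ (sym A≡B))

∁-▷ : A ▷ B → ∁ B ▷ ∁ A
∁-▷ {A = A} {B = B} (A─B≠∅ , B─A≠∅ , B′ , B″ , B′≠∅ , B″≠∅ , disjoint , B′∪B″ , around) =
  subst Nonempty (sym (∁─∁ B A)) A─B≠∅ , subst Nonempty (sym (∁─∁ A B)) B─A≠∅ ,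
  B′ , B″ , B′≠∅ , B″≠∅ , disjoint , trans B′∪B″ (sym (∁─∁ A B)) ,
  λ b′ a b″ b′∈ a∈ b″∈ → around b′ a b″ b′∈ (subst (a ∈_) (∁─∁ B A) a∈) b″∈

∁-ws : ∀ {A B : Subset n} → WeaklySeparated A B → WeaklySeparated (∁ B) (∁ A)
∁-ws (inj₁ A⋖B)        = inj₁ (∁-⋖ A⋖B)
∁-ws (inj₂ (inj₁ B⋖A)) = inj₂ (inj₁ (∁-⋖ B⋖A))
∁-ws {A = A} {B} (inj₂ (inj₂ (inj₁ (A▷B , B≤A)))) =
  inj₂ (inj₂ (inj₁ (∁-▷ A▷B , ∁-antitone B A B≤A)))
∁-ws {A = A} {B} (inj₂ (inj₂ (inj₂ (inj₁ (B▷A , A≤B))))) =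
  inj₂ (inj₂ (inj₂ (inj₁ (∁-▷ B▷A , ∁-antitone A B A≤B))))
∁-ws (inj₂ (inj₂ (inj₂ (inj₂ A≡B)))) = inj₂ (inj₂ (inj₂ (inj₂ (cong ∁ (sym A≡B)))))

∁-lrPair : {L R : Family n} → LRPair L R → LRPair (R ∘ ∁) (L ∘ ∁)
∁-lrPair P = record
  { ws = λ A B A∈ B∈ → subst₂ WeaklySeparated (∁-involutive A) (∁-involutive B)
           (∁-ws (ws (∁ B) (∁ A) (swap B∈) (swap A∈)))
  ; lr = λ A B RA LB A≤B → subst₂ _⋖=_ (∁-involutive A) (∁-involutive B)
           (∁-⋖= (lr (∁ B) (∁ A) LB RA (∁-antitone A B A≤B)))
  }
  where open LRPair P

lrPair-⊆ : {L L′ R R′ : Family n} → (∀ {Y} → L′ Y → L Y) → (∀ {Y} → R′ Y → R Y) →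
           LRPair L R → LRPair L′ R′
lrPair-⊆ L′⊆L R′⊆R P = record
  { ws = λ A B A∈ B∈ → ws A B (⊎-map L′⊆L R′⊆R A∈) (⊎-map L′⊆L R′⊆R B∈)
  ; lr = λ A B LA RB → lr A B (L′⊆L LA) (R′⊆R RB)
  }
  where open LRPair P

insertion-right : {L R : Family n} → LRPair L R → {X : Subset n} {i j k : Fin n} →
                  i ∉ X → j ∉ X → k ∉ X → i ≢ j → j ≢ k → i ≢ k →
                  L (X ∪ ⁅ i ⁆) → L (X ∪ ⁅ j ⁆) → R (X ∪ ⁅ j ⁆) → R (X ∪ ⁅ k ⁆) →
                  LRPair L (R ∪ᶠ singleton X)
insertion-right {L = L} {R} P {X} i∉X j∉X k∉X i≢j j≢k i≢k Li Lj Rj Rk =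
  lrPair-⊆ (λ {Y} LY → subst L (sym (∁-involutive Y)) LY) back (∁-lrPair dual-extended)
  where
  complemented : ∀ (F : Family _) {c} → F (X ∪ ⁅ c ⁆) → F (∁ (∁ X - c))
  complemented F {c} = subst F (sym (∁[∁p─q]≡p∪q X ⁅ c ⁆))
  dual-extended : LRPair ((R ∘ ∁) ∪ᶠ singleton (∁ X)) (L ∘ ∁)
  dual-extended = insertion-left (∁-lrPair P) (x∉p⇒x∈∁p i∉X) (x∉p⇒x∈∁p j∉X) (x∉p⇒x∈∁p k∉X)
    i≢j j≢k i≢k (complemented R Rk) (complemented R Rj) (complemented L Lj) (complemented L Li)
  back : ∀ {Y} → (R ∪ᶠ singleton X) Y → (((R ∘ ∁) ∪ᶠ singleton (∁ X)) ∘ ∁) Y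
  back {Y} (inj₁ RY) = inj₁ (subst R (sym (∁-involutive Y)) RY)
  back (inj₂ refl) = inj₂ refl

lemma4p3 : {n : ℕ} (L R : Family n) → LRPair L R →
    ((X : Subset n) (i j k : Fin n) → i ∈ X → j ∈ X → k ∈ X → i < j → j < k →
      L (X - k) → L (X - j) → R (X - j) → R (X - i) →
      LRPair (L ∪ᶠ singleton X) R)
    ×
    ((X : Subset n) (i j k : Fin n) → i ∉ X → j ∉ X → k ∉ X → i < j → j < k →
      L (X ∪ ⁅ i ⁆) → L (X ∪ ⁅ j ⁆) → R (X ∪ ⁅ j ⁆) → R (X ∪ ⁅ k ⁆) →
      LRPair L (R ∪ᶠ singleton X))
lemma4p3 L R P =
  (λ X i j k i∈X j∈X k∈X i<j j<k →
     insertion-left P i∈X j∈X k∈X (<⇒≢ i<j) (<⇒≢ j<k) (<⇒≢ (<-trans i<j j<k))) ,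
  (λ X i j k i∉X j∉X k∉X i<j j<k →
     insertion-right P i∉X j∉X k∉X (<⇒≢ i<j) (<⇒≢ j<k) (<⇒≢ (<-trans i<j j<k)))
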